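{- Let $G=(V,E)$ be a graph and $u,v\in V$ distinct vertices. Suppose that $|E|=2|V|-2$, $G$ is $uv$-sparse, and $d(w)\ge3$ for all $w\in V$. Then either there is a vertex $z\in V-\{u,v\}$ with $d(z)=3$ and $|N(z)\cap\{u,v\}|\le1$, or there is a 4-cycle in $G$ which contains both $u$ and $v$.
   Context: $d(w)$ is the degree and $N(w)$ the neighbour set of $w$. $i(X)$ counts edges with both ends in $X\subseteq V$; for a family $\mathcal{H}=\{H_1,\dots,H_k\}$, $i(\mathcal{H})$ counts edges with both ends in some $H_j$. For nonempty $H\subseteq V$, $\mathrm{val}(H)=2|H|-t_H$ with $t_H=4$ if $H=\{u,v\}$, $t_H=3$ if $H\ne\{u,v\}$ and $|H|\in\{2,3\}$, $t_H=2$ otherwise. $\mathcal{H}$ is $uv$-compatible if $u,v\in H_j$ and $|H_j|\ge3$ for all $j$, with $\mathrm{val}(\mathcal{H})=\sum_j\mathrm{val}(H_j)-2(k-1)$. $G$ is $uv$-sparse if $i(H)\le\mathrm{val}(H)$ for all $H\subseteq V$ with $|H|\ge2$ and $i(\mathcal{H})\le\mathrm{val}(\mathcal{H})$ for all $uv$-compatible $\mathcal{H}$. -}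

module Defs where

open import Data.Nat using (ℕ; zero; suc; _+_; _*_; _∸_; _≤_; _<_; _≤?_; _<?_)
open import Data.Bool using (Bool; true; false; _∧_; if_then_else_)
open import Data.Fin using (Fin; toℕ)
open import Data.Fin.Subset using (Subset; ∣_∣; ⁅_⁆; _∪_)
open import Data.Vec using (lookup)
open import Data.Vec.Properties using (≡-dec)
open import Data.Bool.Properties using () renaming (_≟_ to _≟B_)
open import Data.List using (List; []; _∷_; map; concatMap; length)
open import Data.Bool.ListAction using (any)
open import Data.Nat.ListAction using (sum)
open import Data.List using () renaming (allFin to allFinL)
open import Data.Product using (_×_; _,_)
import Data.List.Membership.Propositional
open import Relation.Binary.PropositionalEquality using (_≡_)
open import Relation.Nullary.Decidable using (⌊_⌋)

record Graph (n : ℕ) : Set where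
  field
    adj    : Fin n → Fin n → Bool
    sym    : ∀ a b → adj a b ≡ adj b a
    irrefl : ∀ a → adj a a ≡ false
open Graph public

countTrue : List Bool → ℕ
countTrue []           = 0
countTrue (true  ∷ bs) = suc (countTrue bs)
countTrue (false ∷ bs) = countTrue bs

pairs : (n : ℕ) → List (Fin n × Fin n)
pairs n = concatMap (λ a → concatMap (λ b → if ⌊ toℕ a <? toℕ b ⌋ then (a , b) ∷ [] else []) (allFinL n)) (allFinL n)

module _ {n : ℕ} (G : Graph n) where

  edgeCount : ℕ
  edgeCount = countTrue (map (λ { (a , b) → adj G a b }) (pairs n))

  deg : Fin n → ℕ
  deg w = countTrue (map (adj G w) (allFinL n))

  i : Subset n → ℕ
  i X = countTrue (map (λ { (a , b) → adj G a b ∧ lookup X a ∧ lookup X b }) (pairs n))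

  iFam : List (Subset n) → ℕ
  iFam ℋ = countTrue (map (λ { (a , b) → adj G a b ∧ any (λ X → lookup X a ∧ lookup X b) ℋ }) (pairs n))

module _ {n : ℕ} (u v : Fin n) where

  uvSet : Subset n
  uvSet = ⁅ u ⁆ ∪ ⁅ v ⁆

  t : Subset n → ℕ
  t H = if ⌊ ≡-dec _≟B_ H uvSet ⌋ then 4
        else (if ⌊ 2 ≤? ∣ H ∣ ⌋ ∧ ⌊ ∣ H ∣ ≤? 3 ⌋ then 3 else 2)

  -- val(H) = 2|H| - t_H   (never truncated for nonempty H)
  val : Subset n → ℕ
  val H = 2 * ∣ H ∣ ∸ t H

  valFam : List (Subset n) → ℕ
  valFam ℋ = sum (map val ℋ) ∸ 2 * (length ℋ ∸ 1)

  record Compatible (ℋ : List (Subset n)) : Set where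
    field
      nonempty : 1 ≤ length ℋ
      members  : ∀ H → H Data.List.Membership.Propositional.∈ ℋ →
                   (lookup H u ≡ true) × (lookup H v ≡ true) × (3 ≤ ∣ H ∣)

  record Sparse (G : Graph n) : Set where
    field
      sets     : ∀ (H : Subset n) → 2 ≤ ∣ H ∣ → i G H ≤ val H
      families : ∀ (ℋ : List (Subset n)) → Compatible ℋ → iFam G ℋ ≤ valFam ℋ

-- By the handshake lemma the
-- degrees sum to 2|E| = 4n − 4. If every degree-3 vertex outside {u,v} is adjacent to both
-- u and v, then two such vertices a, b close the 4-cycle u a v b; with at most one of them,
-- only three vertices can have degree 3 and all others have degree at least 4, so the
-- degrees would sum to at least 4n − 3.
module Submission where

open import Defs
open import Data.Nat using (ℕ; _*_; _≤_; _+_)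
open import Data.Fin using (Fin)
open import Data.Bool using (true; false)
open import Data.Product using (Σ; ∃; _×_)
open import Data.Sum using (_⊎_)
open import Relation.Binary.PropositionalEquality using (_≡_; _≢_)
open import Relation.Nullary using (¬_)

open import Data.Nat using (zero; suc; _∸_; _<_; _<?_; z≤n)
import Data.Nat.Properties as ℕ
open import Data.Fin using (zero; suc; toℕ; _≟_)
import Data.Fin.Properties as Fin
open import Data.Bool using (Bool; if_then_else_)
open import Data.Bool.Properties using () renaming (_≟_ to _≟ᵇ_)
open import Data.List using (List; []; _∷_; _++_; map; concatMap; tabulate; allFin)
open import Data.List.Properties using (map-++)
open import Data.Product using (_,_)
open import Data.Sum using (inj₁; inj₂)
open import Data.Empty using (⊥-elim)
open import Function using (_∘_; id)
open import Relation.Nullary using (Dec; yes; no; ¬?; _×-dec_)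
open import Relation.Nullary.Decidable using (⌊_⌋; decidable-stable)
open import Relation.Unary using (Pred; Decidable)
open import Data.Nat.Solver using (module +-*-Solver)
open import Relation.Binary.PropositionalEquality using (refl; trans; cong; cong₂)
import Relation.Binary.PropositionalEquality as ≡
open import Algebra.Properties.CommutativeMonoid.Sum ℕ.+-0-commutativeMonoid
  using (sum-syntax; ∑-distrib-+; ∑-comm; sum-cong-≗; sum-replicate-zero)

indicator : Bool → ℕ
indicator true  = 1
indicator false = 0

∑-lowerBound : ∀ {n c} (f : Fin n → ℕ) → (∀ i → c ≤ f i) → n * c ≤ ∑[ i < n ] f i
∑-lowerBound {zero}  f c≤f = z≤n
∑-lowerBound {suc n} f c≤f = ℕ.+-mono-≤ (c≤f zero) (∑-lowerBound (f ∘ suc) (c≤f ∘ suc))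

δ : ∀ {n} → Fin n → Fin n → ℕ
δ zero    zero    = 1
δ zero    (suc _) = 0
δ (suc _) zero    = 0
δ (suc x) (suc w) = δ x w

δ-diagonal : ∀ {n} (x : Fin n) → δ x x ≡ 1
δ-diagonal zero    = refl
δ-diagonal (suc x) = δ-diagonal x

∑-δ : ∀ {n} (x : Fin n) → ∑[ w < n ] δ x w ≡ 1
∑-δ {suc n} zero    = cong suc (sum-replicate-zero n)
∑-δ {suc n} (suc x) = ∑-δ x

∑-atLeast-4n-3 : ∀ {n} (f : Fin n → ℕ) (x y z : Fin n) →
  (∀ w → 3 ≤ f w) → (∀ w → w ≢ x → w ≢ y → w ≢ z → 4 ≤ f w) →
  n * 4 ≤ (∑[ w < n ] f w) + 3
∑-atLeast-4n-3 {n} f x y z 3≤f 4≤f = begin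
  n * 4                                                   ≤⟨ ∑-lowerBound g 4≤g ⟩
  (∑[ w < n ] g w)                                        ≡⟨ ∑-distrib-+ f _ ⟩
  (∑[ w < n ] f w) + (∑[ w < n ] (δ x w + δ y w + δ z w)) ≡⟨ cong ((∑[ w < n ] f w) +_) ∑δ≡3 ⟩
  (∑[ w < n ] f w) + 3                                      ∎
  where
  open ℕ.≤-Reasoning
  g : Fin n → ℕ
  g w = f w + (δ x w + δ y w + δ z w)
  ∑δ≡3 : ∑[ w < n ] (δ x w + δ y w + δ z w) ≡ 3
  ∑δ≡3 = trans (∑-distrib-+ _ (δ z)) (cong₂ _+_
           (trans (∑-distrib-+ (δ x) (δ y)) (cong₂ _+_ (∑-δ x) (∑-δ y))) (∑-δ z))
  1≤δ-diagonal : ∀ w → 1 ≤ δ w w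
  1≤δ-diagonal w = ℕ.≤-reflexive (≡.sym (δ-diagonal w))
  4≤g : ∀ w → 4 ≤ g w
  4≤g w with w ≟ x | w ≟ y | w ≟ z
  ... | yes refl | _ | _ = ℕ.+-mono-≤ (3≤f w)
    (ℕ.≤-trans (1≤δ-diagonal w) (ℕ.≤-trans (ℕ.m≤m+n _ (δ y w)) (ℕ.m≤m+n _ (δ z w))))
  ... | no _ | yes refl | _ = ℕ.+-mono-≤ (3≤f w)
    (ℕ.≤-trans (1≤δ-diagonal w) (ℕ.≤-trans (ℕ.m≤n+m _ (δ x w)) (ℕ.m≤m+n _ (δ z w))))
  ... | no _ | no _ | yes refl = ℕ.+-mono-≤ (3≤f w) (ℕ.≤-trans (1≤δ-diagonal w) (ℕ.m≤n+m _ _))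
  ... | no w≢x | no w≢y | no w≢z = ℕ.≤-trans (4≤f w w≢x w≢y w≢z) (ℕ.m≤m+n _ _)

countTrue-++ : ∀ xs ys → countTrue (xs ++ ys) ≡ countTrue xs + countTrue ys
countTrue-++ []           ys = refl
countTrue-++ (true  ∷ xs) ys = cong suc (countTrue-++ xs ys)
countTrue-++ (false ∷ xs) ys = countTrue-++ xs ys

countTrue-map-tabulate : ∀ {A : Set} {n} (p : A → Bool) (f : Fin n → A) →
  countTrue (map p (tabulate f)) ≡ ∑[ i < n ] indicator (p (f i))
countTrue-map-tabulate {n = zero}  p f = refl
countTrue-map-tabulate {n = suc n} p f with p (f zero)
... | true  = cong suc (countTrue-map-tabulate p (f ∘ suc))
... | false = countTrue-map-tabulate p (f ∘ suc)

countTrue-map-concatMap-tabulate : ∀ {A B : Set} {n} (p : B → Bool) (g : A → List B) (f : Fin n → A) →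
  countTrue (map p (concatMap g (tabulate f))) ≡ ∑[ i < n ] countTrue (map p (g (f i)))
countTrue-map-concatMap-tabulate {n = zero}  p g f = refl
countTrue-map-concatMap-tabulate {n = suc n} p g f = begin
  countTrue (map p (g (f zero) ++ rest))            ≡⟨ cong countTrue (map-++ p (g (f zero)) rest) ⟩
  countTrue (map p (g (f zero)) ++ map p rest)      ≡⟨ countTrue-++ (map p (g (f zero))) (map p rest) ⟩
  countTrue (map p (g (f zero))) + countTrue (map p rest)
    ≡⟨ cong (countTrue (map p (g (f zero))) +_) (countTrue-map-concatMap-tabulate p g (f ∘ suc)) ⟩
  countTrue (map p (g (f zero))) + (∑[ i < n ] countTrue (map p (g (f (suc i))))) ∎
  where
  open ≡.≡-Reasoning
  rest = concatMap g (tabulate (f ∘ suc))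

strictUpper : ∀ {n} → (Fin n → Fin n → ℕ) → Fin n → Fin n → ℕ
strictUpper A a b = if ⌊ toℕ a <? toℕ b ⌋ then A a b else 0

module _ {n} (A : Fin n → Fin n → ℕ) (symmetric : ∀ a b → A a b ≡ A b a) (zeroDiagonal : ∀ a → A a a ≡ 0) where

  strictUpper-+-transpose : ∀ a b → A a b ≡ strictUpper A a b + strictUpper A b a
  strictUpper-+-transpose a b with toℕ a <? toℕ b | toℕ b <? toℕ a
  ... | yes a<b | yes b<a = ⊥-elim (ℕ.<-asym a<b b<a)
  ... | yes _   | no _    = ≡.sym (ℕ.+-identityʳ (A a b))
  ... | no _    | yes _   = symmetric a b
  ... | no a≮b  | no b≮a with Fin.toℕ-injective (ℕ.≤-antisym (ℕ.≮⇒≥ b≮a) (ℕ.≮⇒≥ a≮b))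
  ...   | refl = zeroDiagonal a

  ∑∑-symmetric : ∑[ a < n ] ∑[ b < n ] A a b ≡ 2 * ∑[ a < n ] ∑[ b < n ] strictUpper A a b
  ∑∑-symmetric = begin
    (∑[ a < n ] ∑[ b < n ] A a b)
      ≡⟨ sum-cong-≗ (λ a → sum-cong-≗ (strictUpper-+-transpose a)) ⟩
    (∑[ a < n ] ∑[ b < n ] (strictUpper A a b + strictUpper A b a))
      ≡⟨ sum-cong-≗ (λ a → ∑-distrib-+ (strictUpper A a) (λ b → strictUpper A b a)) ⟩
    (∑[ a < n ] ((∑[ b < n ] strictUpper A a b) + (∑[ b < n ] strictUpper A b a)))
      ≡⟨ ∑-distrib-+ (λ a → ∑[ b < n ] strictUpper A a b) (λ a → ∑[ b < n ] strictUpper A b a) ⟩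
    U + (∑[ a < n ] ∑[ b < n ] strictUpper A b a)
      ≡⟨ cong (U +_) (∑-comm (λ a b → strictUpper A b a)) ⟩
    U + U
      ≡⟨ cong (U +_) (≡.sym (ℕ.+-identityʳ U)) ⟩
    2 * U ∎
    where
    open ≡.≡-Reasoning
    U = ∑[ a < n ] ∑[ b < n ] strictUpper A a b

module _ {n} (G : Graph n) where

  adjacency : Fin n → Fin n → ℕ
  adjacency a b = indicator (adj G a b)

  deg≡∑adjacency : ∀ w → deg G w ≡ ∑[ b < n ] adjacency w b
  deg≡∑adjacency w = countTrue-map-tabulate (adj G w) id

  edgeCount≡∑strictUpper : edgeCount G ≡ ∑[ a < n ] ∑[ b < n ] strictUpper adjacency a b
  edgeCount≡∑strictUpper =
    trans (countTrue-map-concatMap-tabulate isEdge (λ a → concatMap (pairIfLess a) (allFin n)) id) (sum-cong-≗ λ a →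
    trans (countTrue-map-concatMap-tabulate isEdge (pairIfLess a) id) (sum-cong-≗ (countTrue-pairIfLess a)))
    where
    isEdge : Fin n × Fin n → Bool
    isEdge (a , b) = adj G a b
    pairIfLess : Fin n → Fin n → List (Fin n × Fin n)
    pairIfLess a b = if ⌊ toℕ a <? toℕ b ⌋ then (a , b) ∷ [] else []
    countTrue-pairIfLess : ∀ a b → countTrue (map isEdge (pairIfLess a b)) ≡ strictUpper adjacency a b
    countTrue-pairIfLess a b with ⌊ toℕ a <? toℕ b ⌋
    ... | false = refl
    ... | true with adj G a b
    ...   | true  = refl
    ...   | false = refl

  handshake : ∑[ w < n ] deg G w ≡ 2 * edgeCount G
  handshake = begin
    (∑[ w < n ] deg G w)                       ≡⟨ sum-cong-≗ deg≡∑adjacency ⟩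
    (∑[ a < n ] ∑[ b < n ] adjacency a b)      ≡⟨ ∑∑-symmetric adjacency (λ a b → cong indicator (Graph.sym G a b))
                                                                          (λ a → cong indicator (irrefl G a)) ⟩
    2 * (∑[ a < n ] ∑[ b < n ] strictUpper adjacency a b) ≡⟨ cong (2 *_) (≡.sym edgeCount≡∑strictUpper) ⟩
    2 * edgeCount G ∎
    where open ≡.≡-Reasoning

  ¬fewerThanFourOfDegreeThree : edgeCount G ≡ 2 * n ∸ 2 → (∀ w → 3 ≤ deg G w) → (x y z : Fin n) →
    ¬ (∀ w → w ≢ x → w ≢ y → w ≢ z → 4 ≤ deg G w)
  ¬fewerThanFourOfDegreeThree edges 3≤deg x y z 4≤deg = ℕ.<⇒≱ (degreeSum+3<4n n x) (begin
    n * 4                        ≤⟨ ∑-atLeast-4n-3 (deg G) x y z 3≤deg 4≤deg ⟩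
    (∑[ w < n ] deg G w) + 3     ≡⟨ cong (_+ 3) (trans handshake (cong (2 *_) edges)) ⟩
    2 * (2 * n ∸ 2) + 3          ∎)
    where
    open ℕ.≤-Reasoning
    degreeSum+3<4n : ∀ n → Fin n → 2 * (2 * n ∸ 2) + 3 < n * 4
    degreeSum+3<4n (suc m) _ = ℕ.≤-reflexive (begin-equality
      suc (2 * (2 * suc m ∸ 2) + 3)  ≡⟨ cong (λ k → suc (2 * (k ∸ 2) + 3)) (ℕ.*-suc 2 m) ⟩
      suc (2 * (2 * m) + 3)          ≡⟨ solve 1 (λ m → con 1 :+ (con 2 :* (con 2 :* m) :+ con 3) := (con 1 :+ m) :* con 4) refl m ⟩
      suc m * 4                      ∎)
      where open +-*-Solver

twoDistinct⊎atMostOne : ∀ {n p} {P : Pred (Fin n) p} → Decidable P → Fin n →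
  (∃ λ a → ∃ λ b → a ≢ b × P a × P b) ⊎ (∃ λ t → ∀ w → P w → w ≡ t)
twoDistinct⊎atMostOne {P = P} P? default with Fin.any? P?
... | no ∄P = inj₂ (default , λ w Pw → ⊥-elim (∄P (w , Pw)))
... | yes (a , Pa) with Fin.any? (λ b → ¬? (a ≟ b) ×-dec P? b)
...   | yes (b , a≢b , Pb) = inj₁ (a , b , a≢b , Pa , Pb)
...   | no ∄b = inj₂ (a , λ w Pw → decidable-stable (w ≟ a) (λ w≢a → ∄b (w , (w≢a ∘ ≡.sym) , Pw)))

module _ {n} (G : Graph n) (u v : Fin n) where

  CommonNeighbour : Fin n → Set
  CommonNeighbour z = adj G z u ≡ true × adj G z v ≡ true

  commonNeighbour? : ∀ z → Dec (CommonNeighbour z)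
  commonNeighbour? z = (adj G z u ≟ᵇ true) ×-dec (adj G z v ≟ᵇ true)

  DegreeThreeOff : (Fin n → Set) → Fin n → Set
  DegreeThreeOff Q z = z ≢ u × z ≢ v × deg G z ≡ 3 × Q z

  degreeThreeOff? : ∀ {Q} → Decidable Q → Decidable (DegreeThreeOff Q)
  degreeThreeOff? Q? z = ¬? (z ≟ u) ×-dec ¬? (z ≟ v) ×-dec (deg G z ℕ.≟ 3) ×-dec Q? z

  FourCycleThrough : Set
  FourCycleThrough = ∃ λ a → ∃ λ b → ∃ λ c → ∃ λ d →
         (a ≢ b × a ≢ c × a ≢ d × b ≢ c × b ≢ d × c ≢ d)
         × (adj G a b ≡ true × adj G b c ≡ true × adj G c d ≡ true × adj G d a ≡ true)
         × (u ≡ a ⊎ u ≡ b ⊎ u ≡ c ⊎ u ≡ d)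
         × (v ≡ a ⊎ v ≡ b ⊎ v ≡ c ⊎ v ≡ d)

  twoCommonNeighbour⇒fourCycle : u ≢ v → ∀ {a b} → a ≢ b →
    DegreeThreeOff CommonNeighbour a → DegreeThreeOff CommonNeighbour b → FourCycleThrough
  twoCommonNeighbour⇒fourCycle u≢v {a} {b} a≢b (a≢u , a≢v , _ , au , av) (b≢u , b≢v , _ , bu , bv) =
    u , a , v , b
    , (a≢u ∘ ≡.sym , u≢v , b≢u ∘ ≡.sym , a≢v , a≢b , b≢v ∘ ≡.sym)
    , (trans (Graph.sym G u a) au , av , trans (Graph.sym G v b) bv , bu)
    , inj₁ refl , inj₂ (inj₂ (inj₁ refl))

  NotCommonNeighbour : Fin n → Set
  NotCommonNeighbour z = ¬ CommonNeighbour z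

  degreeThree⇒commonNeighbour : ¬ ∃ (DegreeThreeOff NotCommonNeighbour) →
    ∀ w → w ≢ u → w ≢ v → deg G w ≡ 3 → DegreeThreeOff CommonNeighbour w
  degreeThree⇒commonNeighbour ∄z w w≢u w≢v deg≡3 =
    w≢u , w≢v , deg≡3 , decidable-stable (commonNeighbour? w) (λ ¬common → ∄z (w , w≢u , w≢v , deg≡3 , ¬common))

lemma4p7 : ∀ {n : ℕ} (G : Graph n) (u v : Fin n) → u ≢ v →
    edgeCount G ≡ 2 * n Data.Nat.∸ 2 →
    Sparse u v G →
    (∀ w → 3 ≤ deg G w) →
    (∃ λ z → z ≢ u × z ≢ v × deg G z ≡ 3 × ¬ (adj G z u ≡ true × adj G z v ≡ true))
    ⊎ (∃ λ a → ∃ λ b → ∃ λ c → ∃ λ d →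
         (a ≢ b × a ≢ c × a ≢ d × b ≢ c × b ≢ d × c ≢ d)
         × (adj G a b ≡ true × adj G b c ≡ true × adj G c d ≡ true × adj G d a ≡ true)
         × (u ≡ a ⊎ u ≡ b ⊎ u ≡ c ⊎ u ≡ d)
         × (v ≡ a ⊎ v ≡ b ⊎ v ≡ c ⊎ v ≡ d))
lemma4p7 G u v u≢v edges _ 3≤deg
  with Fin.any? (degreeThreeOff? G u v (¬? ∘ commonNeighbour? G u v))
... | yes z = inj₁ z
... | no ∄z with twoDistinct⊎atMostOne (degreeThreeOff? G u v (commonNeighbour? G u v)) u
...   | inj₁ (a , b , a≢b , a-common , b-common) =
          inj₂ (twoCommonNeighbour⇒fourCycle G u v u≢v a≢b a-common b-common)
...   | inj₂ (t , unique) = ⊥-elim (¬fewerThanFourOfDegreeThree G edges 3≤deg u v t 4≤deg)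
  where
  4≤deg : ∀ w → w ≢ u → w ≢ v → w ≢ t → 4 ≤ deg G w
  4≤deg w w≢u w≢v w≢t = ℕ.≤∧≢⇒< (3≤deg w) λ 3≡deg →
    w≢t (unique w (degreeThree⇒commonNeighbour G u v ∄z w w≢u w≢v (≡.sym 3≡deg)))
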